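{- Let $M=(E,\operatorname{rk})$ be a matroid. Then the monoid $\mathcal{Q}(M)$ of multiplicity functions on $M$ is the direct product of the monoids $\mathcal{Q}_p(M)$, one for each prime number $p$, via $m\mapsto(v_p\circ m)_p$, and these monoids $\mathcal{Q}_p(M)$ are all isomorphic to each other. The projections of every element of $\mathcal{Q}(M)$ onto the factors $\mathcal{Q}_p(M)$ are nontrivial only for finitely many primes $p$ (so the product is the restricted direct product of families with finitely many nonzero components).
   Context: A matroid is a pair $(E,\operatorname{rk})$ with $E$ finite and $\operatorname{rk}:2^E\to\mathbb{N}$ satisfying $\operatorname{rk}(X)\le|X|$, $X\subseteq Y\Rightarrow\operatorname{rk}(X)\le\operatorname{rk}(Y)$, and $\operatorname{rk}(X\cup Y)+\operatorname{rk}(X\cap Y)\le\operatorname{rk}(X)+\operatorname{rk}(Y)$. A molecule is a triple $(R,F,T)$ of pairwise disjoint subsets of $E$ such that $\operatorname{rk}(A)=\operatorname{rk}(R)+|A\cap F|$ for all $A$ with $R\subseteq A\subseteq R\cup F\cup T$. A multiplicity function is $m:2^E\to\mathbb{Z}_{>0}$ such that (A1) for all $A\subseteq E$, $e\in E$: if $\operatorname{rk}(A\cup\{e\})>\operatorname{rk}(A)$ then $m(A)\mid m(A\cup\{e\})$, and if $\operatorname{rk}(A\cup\{e\})=\operatorname{rk}(A)$ then $m(A\cup\{e\})\mid m(A)$; (A2) for every molecule $(R,F,T)$, $m(R)m(R\cup F\cup T)=m(R\cup F)m(R\cup T)$. $\mathcal{Q}(M)$ is the set of multiplicity functions, a commutative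 monoid under pointwise product with unit the constant function $1$. For a prime $p$, $v_p(n)$ is the exponent of $p$ in $n$, and $\mathcal{Q}_p(M)=\{v_p\circ m\mid m\in\mathcal{Q}(M)\}\subseteq\mathbb{N}^{2^E}$, an additive monoid. -}

module Defs where

open import Data.Nat using (ℕ; zero; suc; _+_; _*_; _<_; _≤_)
open import Data.Nat.Divisibility using (_∣_; _∣?_)
open import Data.Nat.DivMod using (_/_)
open import Data.Nat.Primality using (Prime)
open import Data.Fin using (Fin)
open import Data.Fin.Subset using (Subset; _⊆_; _∪_; _∩_; ⁅_⁆; ∣_∣; ⊥)
open import Data.Product using (Σ; _×_; ∃)
open import Relation.Nullary using (yes; no)
open import Relation.Binary.PropositionalEquality using (_≡_)

record Matroid (n : ℕ) : Set where
  field
    rk       : Subset n → ℕ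
    rk-card  : ∀ X → rk X ≤ ∣ X ∣
    rk-mono  : ∀ X Y → X ⊆ Y → rk X ≤ rk Y
    rk-submod : ∀ X Y → rk (X ∪ Y) + rk (X ∩ Y) ≤ rk X + rk Y

Disjoint : ∀ {n} → Subset n → Subset n → Set
Disjoint X Y = X ∩ Y ≡ ⊥

IsMolecule : ∀ {n} → Matroid n → Subset n → Subset n → Subset n → Set
IsMolecule {n} M R F T =
  Disjoint R F × Disjoint R T × Disjoint F T ×
  (∀ (A : Subset n) → R ⊆ A → A ⊆ (R ∪ F ∪ T) →
     rk A ≡ rk R + ∣ A ∩ F ∣)
  where open Matroid M

IsMultiplicity : ∀ {n} → Matroid n → (Subset n → ℕ) → Set
IsMultiplicity {n} M m =
  (∀ A → 0 < m A) ×
  (∀ (A : Subset n) (e : Fin n) → rk A < rk (A ∪ ⁅ e ⁆) → m A ∣ m (A ∪ ⁅ e ⁆)) ×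
  (∀ (A : Subset n) (e : Fin n) → rk (A ∪ ⁅ e ⁆) ≡ rk A → m (A ∪ ⁅ e ⁆) ∣ m A) ×
  (∀ R F T → IsMolecule M R F T →
     m R * m (R ∪ F ∪ T) ≡ m (R ∪ F) * m (R ∪ T))
  where open Matroid M

-- p-adic valuation v p k (exponent of p in k), computed with fuel k.
-- Correct for p ≥ 2 and k ≥ 1 (the only cases used).
valAux : ℕ → ℕ → ℕ → ℕ
valAux zero    p       k = 0
valAux (suc f) zero    k = 0
valAux (suc f) (suc q) zero = 0
valAux (suc f) (suc q) (suc j) with suc q ∣? suc j
... | yes _ = suc (valAux f (suc q) (suc j / suc q))
... | no  _ = 0

v : ℕ → ℕ → ℕ
v p k = valAux k p k

InQp : ∀ {n} → Matroid n → ℕ → (Subset n → ℕ) → Set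
InQp {n} M p f = Σ (Subset n → ℕ) λ m → IsMultiplicity M m × (∀ A → v p (m A) ≡ f A)

-- monoid isomorphism Q_p(M) ≅ Q_q(M) (additive monoids, equality pointwise)
QpIso : ∀ {n} → Matroid n → ℕ → ℕ → Set
QpIso {n} M p q =
  Σ ((Subset n → ℕ) → (Subset n → ℕ)) λ φ →
  Σ ((Subset n → ℕ) → (Subset n → ℕ)) λ ψ →
    (∀ f → InQp M p f → InQp M q (φ f)) ×
    (∀ g → InQp M q g → InQp M p (ψ g)) ×
    (∀ f → InQp M p f → ∀ A → ψ (φ f) A ≡ f A) ×
    (∀ g → InQp M q g → ∀ A → φ (ψ g) A ≡ g A) ×
    (∀ A → φ (λ _ → 0) A ≡ 0) ×
    (∀ f g → InQp M p f → InQp M p g →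
       ∀ A → φ (λ B → f B + g B) A ≡ φ f A + φ g A)

module Submission where

-- A multiplicity function takes positive values, so it is determined by its p-adic
-- valuations, and v_p ∘ m vanishes as soon as p exceeds every value of m.  For
-- p prime and q > 0 the map a ↦ q ^ v_p(a) is multiplicative on positive integers,
-- so it preserves divisibility and the molecule identity (A2) and hence maps Q(M)
-- into itself; for q prime this gives Q_p(M) ⊆ Q_q(M), so all the Q_p(M) coincide.
-- A finitely supported family (f_p) is realised by the product of the p ^ f_p over
-- the primes p below the support bound.

open import Data.Bool using (true; false)
open import Data.Fin.Subset using (Subset; _∪_)
open import Data.List using ([]; _∷_)
open import Data.List.Relation.Unary.All using ([]; _∷_)
open import Data.Nat
  using (ℕ; zero; suc; _+_; _*_; _^_; _⊔_; _<_; _≤_; _≤?_; z≤n; s≤s; z<s;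
         nonTrivial⇒n>1; >-nonZero; >-nonZero⁻¹)
open import Data.Nat.Divisibility
  using (_∣_; _∣?_; divides; _∣0; m∣m*n; ∣⇒≤; ∣-refl; ∣1⇒≡1; *-pres-∣)
open import Data.Nat.DivMod using (_/_; m*n/n≡m; m/n<m)
open import Data.Nat.Induction using (<-wellFounded)
open import Data.Nat.ListAction using (product)
open import Data.Nat.Primality
  using (Prime; prime?; euclidsLemma; prime⇒irreducible; ¬prime[1]; prime⇒nonTrivial; prime⇒nonZero)
open import Data.Nat.Primality.Factorisation using (factorise)
open import Data.Nat.Properties
open import Data.Product using (Σ; ∃; ∃₂; _×_; _,_; proj₁; proj₂)
open import Data.Sum using (_⊎_; inj₁; inj₂; [_,_])
open import Data.Vec using ([]; _∷_)
open import Function using (_∘_; id)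
open import Induction.WellFounded using (Acc; acc)
open import Relation.Binary.PropositionalEquality
  using (_≡_; _≢_; refl; sym; trans; cong; cong₂; subst; module ≡-Reasoning)
open import Relation.Nullary using (¬_; Dec; yes; no; contradiction)
open import Defs

∤⇒>0 : ∀ {p a} → ¬ p ∣ a → 0 < a
∤⇒>0 {p} {zero}  p∤0 = contradiction (p ∣0) p∤0
∤⇒>0 {p} {suc a} _   = z<s

m*n>0⇒m>0 : ∀ m {n} → 0 < m * n → 0 < m
m*n>0⇒m>0 (suc m) _ = z<s

prime∤1 : ∀ {p} → Prime p → ¬ p ∣ 1
prime∤1 p-prime p∣1 = ¬prime[1] (subst Prime (∣1⇒≡1 p∣1) p-prime)

prime⇒n>1 : ∀ {p} → Prime p → 1 < p
prime⇒n>1 {p} p-prime = nonTrivial⇒n>1 p {{prime⇒nonTrivial p-prime}}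

prime⇒positive : ∀ {p} → Prime p → 0 < p
prime⇒positive {p} p-prime = >-nonZero⁻¹ p {{prime⇒nonZero p-prime}}

valAux-fuel : ∀ {p f g a} → 1 < p → a ≤ f → a ≤ g → valAux f p a ≡ valAux g p a
valAux-fuel {f = zero}  {zero}  {zero}  (s≤s (s≤s z≤n)) _ _ = refl
valAux-fuel {f = zero}  {suc g} {zero}  (s≤s (s≤s z≤n)) _ _ = refl
valAux-fuel {f = suc f} {zero}  {zero}  (s≤s (s≤s z≤n)) _ _ = refl
valAux-fuel {f = suc f} {suc g} {zero}  (s≤s (s≤s z≤n)) _ _ = refl
valAux-fuel {p@(suc (suc _))} {suc f} {suc g} {suc a} p>1@(s≤s (s≤s z≤n)) (s≤s a≤f) (s≤s a≤g)
  with p ∣? suc a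
... | yes _ = cong suc (valAux-fuel p>1 (≤-trans a/p≤a a≤f) (≤-trans a/p≤a a≤g))
  where
  a/p≤a : suc a / p ≤ a
  a/p≤a = ≤-pred (m/n<m (suc a) p p>1)
... | no _ = refl

-- One step of valAux on p * a leaves fuel j + suc k * a ≥ a for the argument p * a / p = a.
v[p*a]≡1+v[a] : ∀ {p a} → 1 < p → 0 < a → v p (p * a) ≡ suc (v p a)
v[p*a]≡1+v[a] {p@(suc (suc k))} {a@(suc j)} p>1@(s≤s (s≤s z≤n)) z<s with p ∣? p * a
... | yes _ = cong suc (begin
  valAux (j + suc k * a) p (p * a / p)  ≡⟨ cong (valAux (j + suc k * a) p) p*a/p≡a ⟩
  valAux (j + suc k * a) p a            ≡⟨ valAux-fuel p>1 a≤j+[1+k]*a ≤-refl ⟩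
  v p a                                 ∎)
  where
  open ≡-Reasoning
  p*a/p≡a : p * a / p ≡ a
  p*a/p≡a = trans (cong (_/ p) (*-comm p a)) (m*n/n≡m a p)
  a≤j+[1+k]*a : a ≤ j + suc k * a
  a≤j+[1+k]*a = ≤-trans (m≤m+n a (k * a)) (m≤n+m (suc k * a) j)
... | no p∤p*a = contradiction (m∣m*n a) p∤p*a

v≡0 : ∀ {p a} → ¬ p ∣ a → v p a ≡ 0
v≡0 {a = zero}  p∤a = contradiction (_ ∣0) p∤a
v≡0 {zero}  {suc a} p∤a = refl
v≡0 {suc p} {suc a} p∤a with suc p ∣? suc a
... | yes p∣a = contradiction p∣a p∤a
... | no _    = refl

v>0⇒∣ : ∀ {p a} → 0 < v p a → p ∣ a
v>0⇒∣ {p} {a} v>0 with p ∣? a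
... | yes p∣a = p∣a
... | no p∤a  = contradiction (v≡0 p∤a) (>⇒≢ v>0)

module _ {p} (p-prime : Prime p) where

  private
    p>1 : 1 < p
    p>1 = prime⇒n>1 p-prime

  v[1]≡0 : v p 1 ≡ 0
  v[1]≡0 = v≡0 (prime∤1 p-prime)

  p^e>0 : ∀ e → 0 < p ^ e
  p^e>0 = m^n>0 p {{prime⇒nonZero p-prime}}

  v[p^e*r]≡e+v[r] : ∀ e {r} → 0 < r → v p (p ^ e * r) ≡ e + v p r
  v[p^e*r]≡e+v[r] zero    {r} _   = cong (v p) (*-identityˡ r)
  v[p^e*r]≡e+v[r] (suc e) {r} r>0 = begin
    v p (p * p ^ e * r)    ≡⟨ cong (v p) (*-assoc p (p ^ e) r) ⟩
    v p (p * (p ^ e * r))  ≡⟨ v[p*a]≡1+v[a] p>1 (*-mono-< (p^e>0 e) r>0) ⟩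
    suc (v p (p ^ e * r))  ≡⟨ cong suc (v[p^e*r]≡e+v[r] e r>0) ⟩
    suc e + v p r          ∎
    where open ≡-Reasoning

  v[p^e]≡e : ∀ e → v p (p ^ e) ≡ e
  v[p^e]≡e e = begin
    v p (p ^ e)      ≡⟨ cong (v p) (sym (*-identityʳ (p ^ e))) ⟩
    v p (p ^ e * 1)  ≡⟨ v[p^e*r]≡e+v[r] e z<s ⟩
    e + v p 1        ≡⟨ cong (e +_) v[1]≡0 ⟩
    e + 0            ≡⟨ +-identityʳ e ⟩
    e                ∎
    where open ≡-Reasoning

  v[p^e*r]≡e : ∀ e {r} → ¬ p ∣ r → v p (p ^ e * r) ≡ e
  v[p^e*r]≡e e p∤r =
    trans (v[p^e*r]≡e+v[r] e (∤⇒>0 p∤r)) (trans (cong (e +_) (v≡0 p∤r)) (+-identityʳ e))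

  p-free-decomposition : ∀ {a} → 0 < a → ∃₂ λ e r → ¬ p ∣ r × a ≡ p ^ e * r
  p-free-decomposition a>0 = go (<-wellFounded _) a>0
    where
    go : ∀ {a} → Acc _<_ a → 0 < a → ∃₂ λ e r → ¬ p ∣ r × a ≡ p ^ e * r
    go {a} (acc rec) a>0 with p ∣? a
    ... | no p∤a = 0 , a , p∤a , sym (*-identityˡ a)
    ... | yes (divides c refl) with go (rec (m<m*n c p {{>-nonZero c>0}} p>1)) c>0
      where
      c>0 : 0 < c
      c>0 = m*n>0⇒m>0 c a>0
    ...   | e , r , p∤r , refl =
      suc e , r , p∤r , trans (*-comm (p ^ e * r) p) (sym (*-assoc p (p ^ e) r))

  v-* : ∀ {a b} → 0 < a → 0 < b → v p (a * b) ≡ v p a + v p b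
  v-* a>0 b>0
    with e , r , p∤r , refl ← p-free-decomposition a>0
       | f , s , p∤s , refl ← p-free-decomposition b>0 = begin
    v p ((p ^ e * r) * (p ^ f * s))  ≡⟨ cong (v p) ([m*n]*[o*p]≡[m*o]*[n*p] (p ^ e) r (p ^ f) s) ⟩
    v p ((p ^ e * p ^ f) * (r * s))  ≡⟨ cong (λ x → v p (x * (r * s))) (sym (^-distribˡ-+-* p e f)) ⟩
    v p (p ^ (e + f) * (r * s))      ≡⟨ v[p^e*r]≡e (e + f) p∤r*s ⟩
    e + f                            ≡⟨ sym (cong₂ _+_ (v[p^e*r]≡e e p∤r) (v[p^e*r]≡e f p∤s)) ⟩
    v p (p ^ e * r) + v p (p ^ f * s) ∎
    where
    open ≡-Reasoning
    p∤r*s : ¬ p ∣ r * s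
    p∤r*s p∣r*s = [ p∤r , p∤s ] (euclidsLemma r s p-prime p∣r*s)

  v[p]≡1 : v p p ≡ 1
  v[p]≡1 = subst (λ x → v p x ≡ 1) (*-identityʳ p) (v[p^e]≡e 1)

  ∣⇒v>0 : ∀ {a} → 0 < a → p ∣ a → 0 < v p a
  ∣⇒v>0 a>0 (divides c refl) = begin-strict
    0              <⟨ z<s ⟩
    1              ≤⟨ m≤n+m 1 (v p c) ⟩
    v p c + 1      ≡⟨ cong (v p c +_) v[p]≡1 ⟨
    v p c + v p p  ≡⟨ v-* (m*n>0⇒m>0 c a>0) (prime⇒positive p-prime) ⟨
    v p (c * p)    ∎
    where open ≤-Reasoning

v≡0-below : ∀ {p a} → 0 < a → a < p → v p a ≡ 0
v≡0-below {p} {a} a>0 a<p = v≡0 (λ p∣a → <⇒≱ a<p (∣⇒≤ {{>-nonZero a>0}} p∣a))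

v[p^e]≡0 : ∀ {p q} → Prime p → Prime q → p ≢ q → ∀ e → v q (p ^ e) ≡ 0
v[p^e]≡0 p-prime q-prime p≢q zero    = v[1]≡0 q-prime
v[p^e]≡0 {p} {q} p-prime q-prime p≢q (suc e) = begin
  v q (p * p ^ e)        ≡⟨ v-* q-prime (prime⇒positive p-prime) (p^e>0 p-prime e) ⟩
  v q p + v q (p ^ e)    ≡⟨ cong₂ _+_ (v≡0 q∤p) (v[p^e]≡0 p-prime q-prime p≢q e) ⟩
  0                      ∎
  where
  open ≡-Reasoning
  q∤p : ¬ q ∣ p
  q∤p q∣p = [ (λ q≡1 → ¬prime[1] (subst Prime q≡1 q-prime)) , (λ q≡p → p≢q (sym q≡p)) ]
              (prime⇒irreducible p-prime q∣p)

prime-divisor : ∀ {a} → 0 < a → a ≡ 1 ⊎ ∃ λ p → Prime p × p ∣ a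
prime-divisor {a} a>0 with factorise a {{>-nonZero a>0}}
... | record { factors = [] ; isFactorisation = a≡1 } = inj₁ a≡1
... | record { factors = p ∷ ps ; isFactorisation = a≡p*ps ; factorsPrime = p-prime ∷ _ } =
  inj₂ (p , p-prime , divides (product ps) (trans a≡p*ps (*-comm p (product ps))))

v-injective : ∀ {a b} → 0 < a → 0 < b → (∀ p → Prime p → v p a ≡ v p b) → a ≡ b
v-injective a>0 = go (<-wellFounded _) a>0
  where
  ∣-transfer : ∀ {p a b} → Prime p → 0 < a → v p a ≡ v p b → p ∣ a → p ∣ b
  ∣-transfer p-prime a>0 va≡vb p∣a = v>0⇒∣ (subst (0 <_) va≡vb (∣⇒v>0 p-prime a>0 p∣a))
  go : ∀ {a b} → Acc _<_ a → 0 < a → 0 < b → (∀ p → Prime p → v p a ≡ v p b) → a ≡ b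
  go {b = b} (acc rec) a>0 b>0 va≡vb with prime-divisor a>0 | prime-divisor b>0
  ... | inj₁ refl | inj₁ refl = refl
  ... | inj₁ refl | inj₂ (q , q-prime , q∣b) =
    contradiction (∣-transfer q-prime b>0 (sym (va≡vb q q-prime)) q∣b) (prime∤1 q-prime)
  ... | inj₂ (p , p-prime , p∣a@(divides c refl)) | _
    with divides d refl ← ∣-transfer {b = b} p-prime a>0 (va≡vb p p-prime) p∣a =
    cong (_* p) (go (rec (m<m*n c p {{>-nonZero c>0}} (prime⇒n>1 p-prime))) c>0 d>0 vc≡vd)
    where
    c>0 : 0 < c
    c>0 = m*n>0⇒m>0 c a>0
    d>0 : 0 < d
    d>0 = m*n>0⇒m>0 d b>0
    p>0 : 0 < p
    p>0 = prime⇒positive p-prime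
    vc≡vd : ∀ q → Prime q → v q c ≡ v q d
    vc≡vd q q-prime = +-cancelʳ-≡ (v q p) (v q c) (v q d) (begin
      v q c + v q p  ≡⟨ v-* q-prime c>0 p>0 ⟨
      v q (c * p)    ≡⟨ va≡vb q q-prime ⟩
      v q (d * p)    ≡⟨ v-* q-prime d>0 p>0 ⟩
      v q d + v q p  ∎)
      where open ≡-Reasoning

Subset-bounded : ∀ {n} (g : Subset n → ℕ) → ∃ λ B → ∀ A → g A ≤ B
Subset-bounded {zero}  g = g [] , λ { [] → ≤-refl }
Subset-bounded {suc n} g with Subset-bounded (g ∘ (true ∷_)) | Subset-bounded (g ∘ (false ∷_))
... | B₁ , g≤B₁ | B₂ , g≤B₂ = B₁ ⊔ B₂ , λ
  { (true  ∷ A) → ≤-trans (g≤B₁ A) (m≤m⊔n B₁ B₂)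
  ; (false ∷ A) → ≤-trans (g≤B₂ A) (m≤n⊔m B₁ B₂)
  }

v∘-finite-support : ∀ {n} (g : Subset n → ℕ) → (∀ A → 0 < g A) →
                    ∃ λ B → ∀ p → Prime p → B < p → ∀ A → v p (g A) ≡ 0
v∘-finite-support g g>0 with B , g≤B ← Subset-bounded g =
  B , λ p _ B<p A → v≡0-below (g>0 A) (≤-<-trans (g≤B A) B<p)

module _ {n} (M : Matroid n) where

  isMultiplicity-1 : IsMultiplicity M (λ _ → 1)
  isMultiplicity-1 = (λ _ → z<s) , (λ _ _ _ → ∣-refl) , (λ _ _ _ → ∣-refl) , (λ _ _ _ _ → refl)

  isMultiplicity-* : ∀ m m′ → IsMultiplicity M m → IsMultiplicity M m′ →
                     IsMultiplicity M (λ A → m A * m′ A)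
  isMultiplicity-* m m′ (m>0 , m-up , m-down , m-mol) (m′>0 , m′-up , m′-down , m′-mol) =
    (λ A → *-mono-< (m>0 A) (m′>0 A)) ,
    (λ A e rk< → *-pres-∣ (m-up A e rk<) (m′-up A e rk<)) ,
    (λ A e rk≡ → *-pres-∣ (m-down A e rk≡) (m′-down A e rk≡)) ,
    λ R F T mol → begin
      (m R * m′ R) * (m (R ∪ F ∪ T) * m′ (R ∪ F ∪ T))
        ≡⟨ [m*n]*[o*p]≡[m*o]*[n*p] (m R) (m′ R) _ _ ⟩
      (m R * m (R ∪ F ∪ T)) * (m′ R * m′ (R ∪ F ∪ T))
        ≡⟨ cong₂ _*_ (m-mol R F T mol) (m′-mol R F T mol) ⟩
      (m (R ∪ F) * m (R ∪ T)) * (m′ (R ∪ F) * m′ (R ∪ T))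
        ≡⟨ [m*n]*[o*p]≡[m*o]*[n*p] (m (R ∪ F)) _ (m′ (R ∪ F)) _ ⟩
      (m (R ∪ F) * m′ (R ∪ F)) * (m (R ∪ T) * m′ (R ∪ T))
        ∎
    where open ≡-Reasoning

  isMultiplicity-∘ : ∀ (h : ℕ → ℕ) → (∀ {a} → 0 < a → 0 < h a) →
                     (∀ {a b} → 0 < a → 0 < b → h (a * b) ≡ h a * h b) →
                     ∀ {m} → IsMultiplicity M m → IsMultiplicity M (h ∘ m)
  isMultiplicity-∘ h h>0 h-* {m} (m>0 , m-up , m-down , m-mol) =
    h>0 ∘ m>0 ,
    (λ A e rk< → h-∣ (m>0 _) (m-up A e rk<)) ,
    (λ A e rk≡ → h-∣ (m>0 _) (m-down A e rk≡)) ,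
    λ R F T mol → begin
      h (m R) * h (m (R ∪ F ∪ T))    ≡⟨ h-* (m>0 _) (m>0 _) ⟨
      h (m R * m (R ∪ F ∪ T))        ≡⟨ cong h (m-mol R F T mol) ⟩
      h (m (R ∪ F) * m (R ∪ T))      ≡⟨ h-* (m>0 _) (m>0 _) ⟩
      h (m (R ∪ F)) * h (m (R ∪ T))  ∎
    where
    open ≡-Reasoning
    h-∣ : ∀ {a b} → 0 < b → a ∣ b → h a ∣ h b
    h-∣ {a} b>0 (divides c refl) =
      divides (h c) (h-* (m*n>0⇒m>0 c b>0) (m*n>0⇒m>0 a (subst (0 <_) (*-comm c a) b>0)))

  isMultiplicity-^v : ∀ {p q m} → Prime p → 0 < q → IsMultiplicity M m →
                      IsMultiplicity M (λ A → q ^ v p (m A))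
  isMultiplicity-^v {p} {q} p-prime q>0 =
    isMultiplicity-∘ (λ a → q ^ v p a) (λ {a} _ → m^n>0 q {{>-nonZero q>0}} (v p a))
      λ {a} {b} a>0 b>0 → trans (cong (q ^_) (v-* p-prime a>0 b>0)) (^-distribˡ-+-* q (v p a) (v p b))

  InQp-transfer : ∀ {p q f} → Prime p → Prime q → InQp M p f → InQp M q f
  InQp-transfer {p} {q} p-prime q-prime (m , m-mult , v∘m≡f) =
    (λ A → q ^ v p (m A)) ,
    isMultiplicity-^v p-prime (prime⇒positive q-prime) m-mult ,
    λ A → trans (v[p^e]≡e q-prime (v p (m A))) (v∘m≡f A)

  Qp-iso : ∀ {p q} → Prime p → Prime q → QpIso M p q
  Qp-iso p-prime q-prime =
    id , id ,
    (λ _ → InQp-transfer p-prime q-prime) , (λ _ → InQp-transfer q-prime p-prime) ,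
    (λ _ _ _ → refl) , (λ _ _ _ → refl) , (λ _ → refl) , (λ _ _ _ _ _ → refl)

module Realisation {n} (M : Matroid n) (f : ℕ → Subset n → ℕ)
                   (f∈Qp : ∀ p → Prime p → InQp M p (f p)) where

  witness : ∀ {k} → Prime k → Subset n → ℕ
  witness {k} k-prime = proj₁ (f∈Qp k k-prime)

  -- k ^ f k, written through the witness of f k ∈ Q_k(M) so that isMultiplicity-^v applies.
  component : (k : ℕ) → Dec (Prime k) → Subset n → ℕ
  component k (yes k-prime) A = k ^ v k (witness k-prime A)
  component k (no _)        _ = 1

  isMultiplicity-component : ∀ k k-prime? → IsMultiplicity M (component k k-prime?)
  isMultiplicity-component k (yes k-prime) =
    isMultiplicity-^v M k-prime (prime⇒positive k-prime) (proj₁ (proj₂ (f∈Qp k k-prime)))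
  isMultiplicity-component k (no _) = isMultiplicity-1 M

  v-component-≡ : ∀ {q} → Prime q → ∀ q-prime? A → v q (component q q-prime? A) ≡ f q A
  v-component-≡ {q} q-prime (yes q-prime′) A =
    trans (v[p^e]≡e q-prime (v q (witness q-prime′ A))) (proj₂ (proj₂ (f∈Qp q q-prime′)) A)
  v-component-≡ q-prime (no ¬q-prime) A = contradiction q-prime ¬q-prime

  v-component-≢ : ∀ {k q} → Prime q → k ≢ q → ∀ k-prime? A → v q (component k k-prime? A) ≡ 0
  v-component-≢ {k} q-prime k≢q (yes k-prime) A = v[p^e]≡0 k-prime q-prime k≢q (v k (witness k-prime A))
  v-component-≢ q-prime k≢q (no _)        A = v[1]≡0 q-prime

  componentProduct : ℕ → Subset n → ℕ
  componentProduct zero    _ = 1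
  componentProduct (suc N) A = component N (prime? N) A * componentProduct N A

  isMultiplicity-componentProduct : ∀ N → IsMultiplicity M (componentProduct N)
  isMultiplicity-componentProduct zero    = isMultiplicity-1 M
  isMultiplicity-componentProduct (suc N) =
    isMultiplicity-* M _ _ (isMultiplicity-component N (prime? N)) (isMultiplicity-componentProduct N)

  v-componentProduct-suc : ∀ {q} → Prime q → ∀ N A →
    v q (componentProduct (suc N) A) ≡ v q (component N (prime? N) A) + v q (componentProduct N A)
  v-componentProduct-suc q-prime N A =
    v-* q-prime (proj₁ (isMultiplicity-component N (prime? N)) A) (proj₁ (isMultiplicity-componentProduct N) A)

  v-componentProduct-≥ : ∀ {q} → Prime q → ∀ {N} → N ≤ q → ∀ A → v q (componentProduct N A) ≡ 0
  v-componentProduct-≥ q-prime {zero}  _   A = v[1]≡0 q-prime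
  v-componentProduct-≥ q-prime {suc N} N<q A = trans (v-componentProduct-suc q-prime N A)
    (cong₂ _+_ (v-component-≢ q-prime (<⇒≢ N<q) (prime? N) A) (v-componentProduct-≥ q-prime (<⇒≤ N<q) A))

  v-componentProduct-< : ∀ {q} → Prime q → ∀ {N} → q < N → ∀ A → v q (componentProduct N A) ≡ f q A
  v-componentProduct-< {q} q-prime {suc N} q<1+N A with N ≟ q
  ... | yes refl = trans (v-componentProduct-suc q-prime N A) (trans
    (cong₂ _+_ (v-component-≡ q-prime (prime? q) A) (v-componentProduct-≥ q-prime ≤-refl A)) (+-identityʳ _))
  ... | no N≢q = trans (v-componentProduct-suc q-prime N A)
    (cong₂ _+_ (v-component-≢ q-prime N≢q (prime? N) A) (v-componentProduct-< q-prime q<N A))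
    where
    q<N : q < N
    q<N = ≤∧≢⇒< (≤-pred q<1+N) (N≢q ∘ sym)

  realise : (∃ λ B → ∀ p → Prime p → B < p → ∀ A → f p A ≡ 0) →
            Σ (Subset n → ℕ) λ m → IsMultiplicity M m × (∀ p → Prime p → ∀ A → v p (m A) ≡ f p A)
  realise (B , f≡0) = componentProduct (suc B) , isMultiplicity-componentProduct (suc B) , v≡f
    where
    v≡f : ∀ p → Prime p → ∀ A → v p (componentProduct (suc B) A) ≡ f p A
    v≡f p p-prime A with p ≤? B
    ... | yes p≤B = v-componentProduct-< p-prime (s≤s p≤B) A
    ... | no  p≰B = trans (v-componentProduct-≥ p-prime (≰⇒> p≰B) A) (sym (f≡0 p p-prime (≰⇒> p≰B) A))

proposition20 : ∀ {n} (M : Matroid n) →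
    -- Q(M) is a monoid under pointwise product with unit 1
    (IsMultiplicity M (λ _ → 1)) ×
    (∀ m m′ → IsMultiplicity M m → IsMultiplicity M m′ →
       IsMultiplicity M (λ A → m A * m′ A)) ×
    -- m ↦ (v_p ∘ m)_p is a monoid homomorphism
    (∀ p → Prime p → v p 1 ≡ 0) ×
    (∀ m m′ → IsMultiplicity M m → IsMultiplicity M m′ →
       ∀ p → Prime p → ∀ A → v p (m A * m′ A) ≡ v p (m A) + v p (m′ A)) ×
    -- only finitely many components are nontrivial
    (∀ m → IsMultiplicity M m →
       ∃ λ B → ∀ p → Prime p → B < p → ∀ A → v p (m A) ≡ 0) ×
    -- injectivity
    (∀ m m′ → IsMultiplicity M m → IsMultiplicity M m′ →
       (∀ p → Prime p → ∀ A → v p (m A) ≡ v p (m′ A)) →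
       ∀ A → m A ≡ m′ A) ×
    -- surjectivity onto the restricted direct product of the Q_p(M)
    (∀ (f : ℕ → Subset n → ℕ) →
       (∀ p → Prime p → InQp M p (f p)) →
       (∃ λ B → ∀ p → Prime p → B < p → ∀ A → f p A ≡ 0) →
       Σ (Subset n → ℕ) λ m → IsMultiplicity M m ×
         (∀ p → Prime p → ∀ A → v p (m A) ≡ f p A)) ×
    -- the Q_p(M) are pairwise isomorphic monoids
    (∀ p q → Prime p → Prime q → QpIso M p q)
proposition20 M =
  isMultiplicity-1 M ,
  isMultiplicity-* M ,
  (λ _ → v[1]≡0) ,
  (λ m m′ m-mult m′-mult p p-prime A → v-* p-prime (proj₁ m-mult A) (proj₁ m′-mult A)) ,
  (λ m m-mult → v∘-finite-support m (proj₁ m-mult)) ,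
  (λ m m′ m-mult m′-mult v∘m≡v∘m′ A →
     v-injective (proj₁ m-mult A) (proj₁ m′-mult A) (λ p p-prime → v∘m≡v∘m′ p p-prime A)) ,
  (λ f f∈Qp → Realisation.realise M f f∈Qp) ,
  (λ _ _ → Qp-iso M)
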